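{- Let $p$ be an odd prime and $m\in\mathbb Z_p$ with $m\not\equiv 0\pmod p$. Then $$\sum_{k=0}^{p-1}\frac{\binom{2k}k^3}{(16m)^k(2k-1)^2}\equiv\Big(4-\frac{16}m\Big)\sum_{k=0}^{(p-1)/2}\frac{k\binom{2k}k^3}{(16m)^k}+\Big(1+\frac4m\Big)\sum_{k=0}^{(p-1)/2}\frac{\binom{2k}k^3}{(16m)^k}-\frac6m\sum_{k=0}^{(p-1)/2}\frac{\binom{2k}k^3}{(16m)^k(k+1)}\pmod{p^3}.$$
   Context: $\mathbb Z_p$ denotes the ring of rational numbers whose denominators are not divisible by $p$; congruences are in $\mathbb Z_p$. -}

module Defs where

open import Data.Nat as ℕ using (ℕ; zero; suc; _∸_; NonZero)
open import Data.Nat.Divisibility using (_∣_)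
open import Data.Nat.Combinatorics using (_C_)
open import Data.Integer as ℤ using (ℤ; +_)
open import Data.Rational as ℚ using (ℚ; ↧ₙ_; _/_; 1/_)
open import Data.Product using (∃; _×_)
open import Relation.Binary.PropositionalEquality using (_≡_)
open import Relation.Nullary using (¬_)

InZp : ℕ → ℚ → Set
InZp p x = ¬ (p ∣ (↧ₙ x))

CongMod : ℕ → ℕ → ℚ → ℚ → Set
CongMod p e a b = ∃ λ c → InZp p c × (a ℚ.- b ≡ ((+ (p ℕ.^ e)) / 1) ℚ.* c)

_^ℚ_ : ℚ → ℕ → ℚ
x ^ℚ zero = ℚ.1ℚ
x ^ℚ suc n = x ℚ.* (x ^ℚ n)

sumTo : ℕ → (ℕ → ℚ) → ℚ
sumTo zero f = f 0
sumTo (suc n) f = sumTo n f ℚ.+ f (suc n)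

-- |2k - 1| as a natural number (equals 1 for k = 0)
absOdd : ℕ → ℕ
absOdd zero = 1
absOdd (suc j) = suc (j ℕ.+ j)

oddSq : ℕ → ℕ
oddSq k = absOdd k ℕ.* absOdd k

oddSq-nonZero : ∀ k → NonZero (oddSq k)
oddSq-nonZero zero = _
oddSq-nonZero (suc j) = _

cb : ℕ → ℤ
cb k = + (((2 ℕ.* k) C k) ℕ.^ 3)

inv16 : (m : ℚ) → .{{ℚ.NonZero m}} → ℚ
inv16 m = (1/ m) ℚ.* ((+ 1) / 16)

-- Write y = 1/(16m) and a k = binom(2k,k)³/(2k-1)².  With the certificate
-- R(K) = 4K²(4K-3), the k-th summand on the left minus the k-th summand on
-- the right equals G(k+1) - G(k) for G(k) = R(k) a k y^k (a Gosper-type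
-- telescoping), so with n = (p-1)/2 the difference of the two sides is
-- G(n+1) + Σ_{n<k<p} a k y^k.  For n < k < p the prime p divides binom(2k,k),
-- so p³ divides the numerator of a k.  For n+1 < k < p the denominator
-- (2k-1)² is prime to p; for k = n+1 it is p², but then
-- G(n+1) + a (n+1) y^(n+1) = (R(n+1) + 1) a (n+1) y^(n+1) and R(n+1) + 1 = p²(2p+3).
module Submission where

open import Defs
open import Data.Empty using (⊥-elim)
open import Data.Integer as ℤ using (+_)
import Data.Integer.GCD as ℤ
import Data.Integer.Properties as ℤ
open import Data.Nat as ℕ using (ℕ; zero; suc; NonZero; _<_; _≤_; _∸_; z≤n; s≤s)
open import Data.Nat.Combinatorics using (_C_; nCk≡n!/k![n-k]!; k![n∸k]!∣n!)
open import Data.Nat.DivMod using (m*[n/m]≡n; m*n/n≡m)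
open import Data.Nat.Divisibility
open import Data.Nat.Primality using (Prime; euclidsLemma; ¬prime[1])
import Data.Nat.Properties as ℕ
import Data.Nat.Solver
open import Data.Product using (∃; _×_; _,_; uncurry)
open import Data.Rational as ℚ using (ℚ; mkℚ; _/_; 1/_; ↥_; ↧ₙ_; 1ℚ; _+_; _*_; _-_)
import Data.Rational.Properties as ℚ
import Data.Rational.Solver
import Data.Rational.Unnormalised as ℚᵘ
import Data.Rational.Unnormalised.Properties as ℚᵘ
open import Data.Sum using (_⊎_; inj₁; inj₂; [_,_]′; reduce)
open import Function using (_∘_)
open import Relation.Binary.PropositionalEquality
open import Relation.Nullary using (¬_)

module ℕ-Solver = Data.Nat.Solver.+-*-Solver

fromℕ : ℕ → ℚ
fromℕ n = + n / 1

module ℚ-Solver where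
  open Data.Rational.Solver.+-*-Solver public

  ⟨_⟩ : ∀ {m} → ℕ → Polynomial m
  ⟨ n ⟩ = con (fromℕ n)

/-cross : ∀ a b d e .{{_ : NonZero d}} .{{_ : NonZero e}} →
          a ℕ.* e ≡ b ℕ.* d → + a / d ≡ + b / e
/-cross a b (suc d) (suc e) eq =
  ℚ.fromℚᵘ-cong {ℚᵘ.mkℚᵘ (+ a) d} {ℚᵘ.mkℚᵘ (+ b) e} (ℚᵘ.*≡* (begin
    + a ℤ.* + suc e  ≡⟨ ℤ.pos-* a (suc e) ⟨
    + (a ℕ.* suc e)  ≡⟨ cong +_ eq ⟩
    + (b ℕ.* suc d)  ≡⟨ ℤ.pos-* b (suc d) ⟩
    + b ℤ.* + suc d  ∎))
  where open ≡-Reasoning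

/-*-/ : ∀ a b d e .{{_ : NonZero d}} .{{_ : NonZero e}} →
        (+ a / d) * (+ b / e) ≡ (+ (a ℕ.* b) / (d ℕ.* e)) {{ℕ.m*n≢0 d e}}
/-*-/ a b (suc d) (suc e) = ℚ.toℚᵘ-injective (begin
  ℚ.toℚᵘ ((+ a / suc d) * (+ b / suc e))
    ≈⟨ ℚ.toℚᵘ-homo-* (+ a / suc d) (+ b / suc e) ⟩
  ℚ.toℚᵘ (+ a / suc d) ℚᵘ.* ℚ.toℚᵘ (+ b / suc e)
    ≈⟨ ℚᵘ.*-cong (ℚ.toℚᵘ-fromℚᵘ (ℚᵘ.mkℚᵘ (+ a) d)) (ℚ.toℚᵘ-fromℚᵘ (ℚᵘ.mkℚᵘ (+ b) e)) ⟩
  ℚᵘ.mkℚᵘ (+ a ℤ.* + b) _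
    ≡⟨ cong (λ z → ℚᵘ.mkℚᵘ z _) (ℤ.pos-* a b) ⟨
  ℚᵘ.mkℚᵘ (+ (a ℕ.* b)) _
    ≈⟨ ℚ.toℚᵘ-fromℚᵘ (ℚᵘ.mkℚᵘ (+ (a ℕ.* b)) _) ⟨
  ℚ.toℚᵘ (+ (a ℕ.* b) / (suc d ℕ.* suc e)) ∎)
  where open ℚᵘ.≃-Reasoning

/-+-/ : ∀ a b d e .{{_ : NonZero d}} .{{_ : NonZero e}} →
        (+ a / d) + (+ b / e) ≡ (+ (a ℕ.* e ℕ.+ b ℕ.* d) / (d ℕ.* e)) {{ℕ.m*n≢0 d e}}
/-+-/ a b (suc d) (suc e) = ℚ.toℚᵘ-injective (begin
  ℚ.toℚᵘ ((+ a / suc d) + (+ b / suc e))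
    ≈⟨ ℚ.toℚᵘ-homo-+ (+ a / suc d) (+ b / suc e) ⟩
  ℚ.toℚᵘ (+ a / suc d) ℚᵘ.+ ℚ.toℚᵘ (+ b / suc e)
    ≈⟨ ℚᵘ.+-cong (ℚ.toℚᵘ-fromℚᵘ (ℚᵘ.mkℚᵘ (+ a) d)) (ℚ.toℚᵘ-fromℚᵘ (ℚᵘ.mkℚᵘ (+ b) e)) ⟩
  ℚᵘ.mkℚᵘ (+ a ℤ.* + suc e ℤ.+ + b ℤ.* + suc d) _
    ≡⟨ cong (λ z → ℚᵘ.mkℚᵘ z _) numerator ⟨
  ℚᵘ.mkℚᵘ (+ (a ℕ.* suc e ℕ.+ b ℕ.* suc d)) _
    ≈⟨ ℚ.toℚᵘ-fromℚᵘ (ℚᵘ.mkℚᵘ (+ (a ℕ.* suc e ℕ.+ b ℕ.* suc d)) _) ⟨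
  ℚ.toℚᵘ (+ (a ℕ.* suc e ℕ.+ b ℕ.* suc d) / (suc d ℕ.* suc e)) ∎)
  where
  open ℚᵘ.≃-Reasoning
  numerator : + (a ℕ.* suc e ℕ.+ b ℕ.* suc d) ≡ + a ℤ.* + suc e ℤ.+ + b ℤ.* + suc d
  numerator = trans (ℤ.pos-+ (a ℕ.* suc e) (b ℕ.* suc d))
                    (cong₂ ℤ._+_ (ℤ.pos-* a (suc e)) (ℤ.pos-* b (suc d)))

fromℕ-+ : ∀ a b → fromℕ (a ℕ.+ b) ≡ fromℕ a + fromℕ b
fromℕ-+ a b = sym (trans (/-+-/ a b 1 1) (/-cross (a ℕ.* 1 ℕ.+ b ℕ.* 1) (a ℕ.+ b) 1 1
  (cong (ℕ._* 1) (cong₂ ℕ._+_ (ℕ.*-identityʳ a) (ℕ.*-identityʳ b)))))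

fromℕ-* : ∀ a b → fromℕ (a ℕ.* b) ≡ fromℕ a * fromℕ b
fromℕ-* a b = sym (trans (/-*-/ a b 1 1) (/-cross (a ℕ.* b) (a ℕ.* b) 1 1 refl))

fromℕ-*-/ : ∀ a b d .{{_ : NonZero d}} → fromℕ a * (+ b / d) ≡ + (a ℕ.* b) / d
fromℕ-*-/ a b d = trans (/-*-/ a b 1 d) (/-cross (a ℕ.* b) (a ℕ.* b) (1 ℕ.* d) d {{ℕ.m*n≢0 1 d}}
  (cong (a ℕ.* b ℕ.*_) (sym (ℕ.*-identityˡ d))))

/-*-cancel : ∀ a d .{{_ : NonZero d}} → (+ a / d) * fromℕ d ≡ fromℕ a
/-*-cancel a d = trans (/-*-/ a d d 1) (/-cross (a ℕ.* d) a (d ℕ.* 1) 1 {{ℕ.m*n≢0 d 1}} (ℕ.*-assoc a d 1))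

fromℕ-suc : ∀ k → fromℕ (suc k) ≡ 1ℚ + fromℕ k
fromℕ-suc k = fromℕ-+ 1 k

fromℕ-+1 : ∀ k → fromℕ k + 1ℚ ≡ fromℕ (suc k)
fromℕ-+1 k = trans (ℚ.+-comm (fromℕ k) 1ℚ) (sym (fromℕ-suc k))

fromℕ-2k+1 : ∀ k → fromℕ (suc (k ℕ.+ k)) ≡ fromℕ 2 * fromℕ k + 1ℚ
fromℕ-2k+1 k = begin
  fromℕ (1 ℕ.+ (k ℕ.+ k))     ≡⟨ fromℕ-+ 1 (k ℕ.+ k) ⟩
  1ℚ + fromℕ (k ℕ.+ k)        ≡⟨ cong (λ x → 1ℚ + x) (fromℕ-+ k k) ⟩
  1ℚ + (fromℕ k + fromℕ k)    ≡⟨ solve 1 (λ K → ⟨ 1 ⟩ :+ (K :+ K) := ⟨ 2 ⟩ :* K :+ ⟨ 1 ⟩) refl (fromℕ k) ⟩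
  fromℕ 2 * fromℕ k + 1ℚ      ∎
  where
  open ≡-Reasoning
  open ℚ-Solver

fromℕ-oddSq : ∀ k → fromℕ (oddSq k) ≡ (fromℕ 2 * fromℕ k - 1ℚ) * (fromℕ 2 * fromℕ k - 1ℚ)
fromℕ-oddSq zero    = refl
fromℕ-oddSq (suc j) = trans (fromℕ-* (suc (j ℕ.+ j)) (suc (j ℕ.+ j))) (cong (λ o → o * o) 2j+1≡2[j+1]-1)
  where
  open ≡-Reasoning
  open ℚ-Solver
  2j+1≡2[j+1]-1 : fromℕ (suc (j ℕ.+ j)) ≡ fromℕ 2 * fromℕ (suc j) - 1ℚ
  2j+1≡2[j+1]-1 = begin
    fromℕ (suc (j ℕ.+ j))          ≡⟨ fromℕ-2k+1 j ⟩
    fromℕ 2 * fromℕ j + 1ℚ         ≡⟨ solve 1 (λ J → ⟨ 2 ⟩ :* J :+ ⟨ 1 ⟩ := ⟨ 2 ⟩ :* (⟨ 1 ⟩ :+ J) :- ⟨ 1 ⟩) refl (fromℕ j) ⟩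
    fromℕ 2 * (1ℚ + fromℕ j) - 1ℚ  ≡⟨ cong (λ x → fromℕ 2 * x - 1ℚ) (fromℕ-suc j) ⟨
    fromℕ 2 * fromℕ (suc j) - 1ℚ   ∎

↧ₙ-/-∣ : ∀ i d .{{_ : NonZero d}} → ↧ₙ (i / d) ∣ d
↧ₙ-/-∣ i d = divides g (begin
  d                                  ≡⟨ cong ℤ.∣_∣ (ℚ.↧-/ i d) ⟨
  ℤ.∣ ℚ.↧ (i / d) ℤ.* ℤ.gcd i (+ d) ∣  ≡⟨ ℤ.abs-* (ℚ.↧ (i / d)) (ℤ.gcd i (+ d)) ⟩
  ↧ₙ (i / d) ℕ.* g                   ≡⟨ ℕ.*-comm (↧ₙ (i / d)) g ⟩
  g ℕ.* ↧ₙ (i / d)                   ∎)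
  where
  open ≡-Reasoning
  g = ℤ.∣ ℤ.gcd i (+ d) ∣

InZp-1/ : ∀ {p} x .{{_ : ℚ.NonZero x}} → ¬ p ∣ ℤ.∣ ↥ x ∣ → InZp p (1/ x)
InZp-1/ (mkℚ ℤ.+[1+ n ] d _) p∤↥x = p∤↥x
InZp-1/ (mkℚ ℤ.-[1+ n ] d _) p∤↥x = p∤↥x

∤-between : ∀ {p o} → p < o → o < p ℕ.+ p → ¬ p ∣ o
∤-between p<o o<2p (divides zero refl)                = ℕ.n≮0 p<o
∤-between {p} p<o o<2p (divides (suc zero) refl)     = ℕ.<-irrefl (sym (ℕ.+-identityʳ p)) p<o
∤-between {p} p<o o<2p (divides (suc (suc q)) refl)  = ℕ.<⇒≱ o<2p (ℕ.+-monoʳ-≤ p (ℕ.m≤m+n p (q ℕ.* p)))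

module _ {p : ℕ} (p-prime : Prime p) where

  prime-∤-* : ∀ {a b} → ¬ p ∣ a → ¬ p ∣ b → ¬ p ∣ a ℕ.* b
  prime-∤-* {a} {b} p∤a p∤b = [ p∤a , p∤b ]′ ∘ euclidsLemma a b p-prime

  prime-∤-1 : ¬ p ∣ 1
  prime-∤-1 p∣1 = ¬prime[1] (subst Prime (∣1⇒≡1 p∣1) p-prime)

  InZp-/ : ∀ i d .{{_ : NonZero d}} → ¬ p ∣ d → InZp p (i / d)
  InZp-/ i d p∤d p∣↧ = p∤d (∣-trans p∣↧ (↧ₙ-/-∣ i d))

  InZp-fromℕ : ∀ n → InZp p (fromℕ n)
  InZp-fromℕ n = InZp-/ (+ n) 1 prime-∤-1

  InZp-+ : ∀ x y → InZp p x → InZp p y → InZp p (x + y)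
  InZp-+ x@record{} y@record{} x∈ y∈ =
    InZp-/ (↥ x ℤ.* ℚ.↧ y ℤ.+ ↥ y ℤ.* ℚ.↧ x) (↧ₙ x ℕ.* ↧ₙ y) (prime-∤-* x∈ y∈)

  InZp-* : ∀ x y → InZp p x → InZp p y → InZp p (x * y)
  InZp-* x@record{} y@record{} x∈ y∈ =
    InZp-/ (↥ x ℤ.* ↥ y) (↧ₙ x ℕ.* ↧ₙ y) (prime-∤-* x∈ y∈)

  InZp-^ : ∀ x → InZp p x → ∀ k → InZp p (x ^ℚ k)
  InZp-^ x x∈ zero    = InZp-fromℕ 1
  InZp-^ x x∈ (suc k) = InZp-* x (x ^ℚ k) x∈ (InZp-^ x x∈ k)

-- x ∈ c ℤ_p; note that CongMod p e a b unfolds to Multiple p (fromℕ (p ^ e)) (a - b).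
Multiple : ℕ → ℚ → ℚ → Set
Multiple p c x = ∃ λ z → InZp p z × x ≡ c * z

module _ {p : ℕ} (p-prime : Prime p) {c : ℚ} where

  Multiple-+ : ∀ {x y} → Multiple p c x → Multiple p c y → Multiple p c (x + y)
  Multiple-+ (z , z∈ , refl) (w , w∈ , refl) =
    z + w , InZp-+ p-prime z w z∈ w∈ , sym (ℚ.*-distribˡ-+ c z w)

  Multiple-sumTo-extend : ∀ {s l f r} → Multiple p c (sumTo s f - r) →
    (∀ i → i < l → Multiple p c (f (suc s ℕ.+ i))) →
    Multiple p c (sumTo (s ℕ.+ l) f - r)
  Multiple-sumTo-extend {s} {zero} head _ rewrite ℕ.+-identityʳ s = head
  Multiple-sumTo-extend {s} {suc l} {f} {r} head tail rewrite ℕ.+-suc s l =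
    subst (Multiple p c)
      (solve 3 (λ S x r → (S :- r) :+ x := (S :+ x) :- r) refl (sumTo (s ℕ.+ l) f) (f (suc s ℕ.+ l)) r)
      (Multiple-+ (Multiple-sumTo-extend {s} {l} {f} {r} head (λ i i<l → tail i (ℕ.m<n⇒m<1+n i<l)))
                  (tail l ℕ.≤-refl))
    where open ℚ-Solver

nCk*k!*[n∸k]!≡n! : ∀ {n k} → k ≤ n → (n C k) ℕ.* (k ℕ.! ℕ.* (n ∸ k) ℕ.!) ≡ n ℕ.!
nCk*k!*[n∸k]!≡n! {n} {k} k≤n = begin
  (n C k) ℕ.* d          ≡⟨ cong (ℕ._* d) (nCk≡n!/k![n-k]! k≤n) ⟩
  (n ℕ.! ℕ./ d) ℕ.* d    ≡⟨ ℕ.*-comm (n ℕ.! ℕ./ d) d ⟩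
  d ℕ.* (n ℕ.! ℕ./ d)    ≡⟨ m*[n/m]≡n (k![n∸k]!∣n! k≤n) ⟩
  n ℕ.!                  ∎
  where
  open ≡-Reasoning
  d = k ℕ.! ℕ.* (n ∸ k) ℕ.!
  instance _ = ℕ._!*_!≢0 k (n ∸ k)

centralBinomial : ℕ → ℕ
centralBinomial k = (2 ℕ.* k) C k

centralBinomial-factorials : ∀ k → centralBinomial k ℕ.* (k ℕ.! ℕ.* k ℕ.!) ≡ (2 ℕ.* k) ℕ.!
centralBinomial-factorials k =
  subst (λ j → centralBinomial k ℕ.* (k ℕ.! ℕ.* j ℕ.!) ≡ (2 ℕ.* k) ℕ.!) 2k∸k≡k (nCk*k!*[n∸k]!≡n! k≤2k)
  where
  k≤2k : k ≤ 2 ℕ.* k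
  k≤2k = ℕ.m≤m+n k (k ℕ.+ 0)
  2k∸k≡k : 2 ℕ.* k ∸ k ≡ k
  2k∸k≡k = trans (ℕ.m+n∸m≡n k (k ℕ.+ 0)) (ℕ.+-identityʳ k)

centralBinomial-suc : ∀ k → centralBinomial (suc k) ℕ.* suc k ≡ 2 ℕ.* suc (2 ℕ.* k) ℕ.* centralBinomial k
centralBinomial-suc k = ℕ.*-cancelʳ-≡ _ _ (suc k ℕ.* (k ℕ.! ℕ.* k ℕ.!)) {{nonZero}} (begin
  C₁ ℕ.* suc k ℕ.* (suc k ℕ.* (k ℕ.! ℕ.* k ℕ.!))
    ≡⟨ solve 3 (λ c k f → c :* (con 1 :+ k) :* ((con 1 :+ k) :* (f :* f))
                       := c :* (((con 1 :+ k) :* f) :* ((con 1 :+ k) :* f))) refl C₁ k (k ℕ.!) ⟩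
  C₁ ℕ.* (suc k ℕ.! ℕ.* suc k ℕ.!)
    ≡⟨ centralBinomial-factorials (suc k) ⟩
  (2 ℕ.* suc k) ℕ.!
    ≡⟨ cong ℕ._! (solve 1 (λ k → con 2 :* (con 1 :+ k) := con 2 :+ con 2 :* k) refl k) ⟩
  suc (suc (2 ℕ.* k)) ℕ.* (suc (2 ℕ.* k) ℕ.* (2 ℕ.* k) ℕ.!)
    ≡⟨ cong (λ x → suc (suc (2 ℕ.* k)) ℕ.* (suc (2 ℕ.* k) ℕ.* x)) (centralBinomial-factorials k) ⟨
  suc (suc (2 ℕ.* k)) ℕ.* (suc (2 ℕ.* k) ℕ.* (C₀ ℕ.* (k ℕ.! ℕ.* k ℕ.!)))
    ≡⟨ solve 3 (λ c k f → (con 2 :+ con 2 :* k) :* ((con 1 :+ con 2 :* k) :* (c :* (f :* f)))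
                       := con 2 :* (con 1 :+ con 2 :* k) :* c :* ((con 1 :+ k) :* (f :* f))) refl C₀ k (k ℕ.!) ⟩
  2 ℕ.* suc (2 ℕ.* k) ℕ.* C₀ ℕ.* (suc k ℕ.* (k ℕ.! ℕ.* k ℕ.!)) ∎)
  where
  open ≡-Reasoning
  open ℕ-Solver
  C₀ = centralBinomial k
  C₁ = centralBinomial (suc k)
  nonZero : NonZero (suc k ℕ.* (k ℕ.! ℕ.* k ℕ.!))
  nonZero = ℕ.m*n≢0 (suc k) _ {{_}} {{ℕ._!*_!≢0 k k}}

prime∣n!⇒≤ : ∀ {p} → Prime p → ∀ n → p ∣ n ℕ.! → p ≤ n
prime∣n!⇒≤ p-prime zero    p∣1 = ⊥-elim (prime-∤-1 p-prime p∣1)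
prime∣n!⇒≤ p-prime (suc n) p∣n! with euclidsLemma (suc n) (n ℕ.!) p-prime p∣n!
... | inj₁ p∣1+n = ∣⇒≤ p∣1+n
... | inj₂ p∣n!  = ℕ.m≤n⇒m≤1+n (prime∣n!⇒≤ p-prime n p∣n!)

prime∣centralBinomial : ∀ {p} → Prime p → ∀ {k} → k < p → p ≤ 2 ℕ.* k → p ∣ centralBinomial k
prime∣centralBinomial {suc q} p-prime {k} k<p p≤2k
  with euclidsLemma (centralBinomial k) (k ℕ.! ℕ.* k ℕ.!) p-prime p∣C*k!k!
  where
  p∣C*k!k! : suc q ∣ centralBinomial k ℕ.* (k ℕ.! ℕ.* k ℕ.!)
  p∣C*k!k! = subst (suc q ∣_) (sym (centralBinomial-factorials k)) (∣-trans (m∣m*n (q ℕ.!)) (m≤n⇒m!∣n! p≤2k))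
... | inj₁ p∣C    = p∣C
... | inj₂ p∣k!k! =
  ⊥-elim (ℕ.<⇒≱ k<p (prime∣n!⇒≤ p-prime k (reduce (euclidsLemma (k ℕ.!) (k ℕ.!) p-prime p∣k!k!))))

cb/oddSq cb/suc cb/1 : ℕ → ℚ
cb/oddSq k = (cb k / oddSq k) {{oddSq-nonZero k}}
cb/suc k   = cb k / suc k
cb/1 k     = cb k / 1

cb/oddSq-*-oddSq : ∀ k → cb/oddSq k * ((fromℕ 2 * fromℕ k - 1ℚ) * (fromℕ 2 * fromℕ k - 1ℚ)) ≡ cb/1 k
cb/oddSq-*-oddSq k = trans (cong (cb/oddSq k *_) (sym (fromℕ-oddSq k)))
                           (/-*-cancel (centralBinomial k ℕ.^ 3) (oddSq k) {{oddSq-nonZero k}})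

cb/suc-*-suc : ∀ k → cb/suc k * (fromℕ k + 1ℚ) ≡ cb/1 k
cb/suc-*-suc k = trans (cong (cb/suc k *_) (fromℕ-+1 k)) (/-*-cancel (centralBinomial k ℕ.^ 3) (suc k))

cb/oddSq-suc : ∀ k → cb/oddSq (suc k) * ((fromℕ k + 1ℚ) * (fromℕ k + 1ℚ))
                   ≡ fromℕ 8 * (fromℕ 2 * fromℕ k + 1ℚ) * cb/suc k
cb/oddSq-suc k = begin
  cb/oddSq (suc k) * ((fromℕ k + 1ℚ) * (fromℕ k + 1ℚ))
    ≡⟨ cong (λ x → cb/oddSq (suc k) * (x * x)) (fromℕ-+1 k) ⟩
  cb/oddSq (suc k) * (fromℕ (suc k) * fromℕ (suc k))
    ≡⟨ cong (cb/oddSq (suc k) *_) (fromℕ-* (suc k) (suc k)) ⟨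
  cb/oddSq (suc k) * fromℕ (suc k ℕ.* suc k)
    ≡⟨ /-*-/ (C₁ ℕ.^ 3) (suc k ℕ.* suc k) (o ℕ.* o) 1 ⟩
  + (C₁ ℕ.^ 3 ℕ.* (suc k ℕ.* suc k)) / (o ℕ.* o ℕ.* 1)
    ≡⟨ /-cross (C₁ ℕ.^ 3 ℕ.* (suc k ℕ.* suc k)) (8 ℕ.* o ℕ.* C₀ ℕ.^ 3) (o ℕ.* o ℕ.* 1) (1 ℕ.* suc k) cross ⟩
  + (8 ℕ.* o ℕ.* C₀ ℕ.^ 3) / (1 ℕ.* suc k)
    ≡⟨ /-*-/ (8 ℕ.* o) (C₀ ℕ.^ 3) 1 (suc k) ⟨
  fromℕ (8 ℕ.* o) * cb/suc k
    ≡⟨ cong (_* cb/suc k) (trans (fromℕ-* 8 o) (cong (fromℕ 8 *_) (fromℕ-2k+1 k))) ⟩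
  fromℕ 8 * (fromℕ 2 * fromℕ k + 1ℚ) * cb/suc k ∎
  where
  open ≡-Reasoning
  o = suc (k ℕ.+ k)
  C₀ = centralBinomial k
  C₁ = centralBinomial (suc k)
  cross : C₁ ℕ.^ 3 ℕ.* (suc k ℕ.* suc k) ℕ.* (1 ℕ.* suc k) ≡ 8 ℕ.* o ℕ.* C₀ ℕ.^ 3 ℕ.* (o ℕ.* o ℕ.* 1)
  cross = begin
    C₁ ℕ.^ 3 ℕ.* (suc k ℕ.* suc k) ℕ.* (1 ℕ.* suc k)
      ≡⟨ solve 2 (λ c k → (c :^ 3) :* (k :* k) :* (con 1 :* k) := (c :* k) :^ 3) refl C₁ (suc k) ⟩
    (C₁ ℕ.* suc k) ℕ.^ 3
      ≡⟨ cong (ℕ._^ 3) (centralBinomial-suc k) ⟩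
    (2 ℕ.* suc (2 ℕ.* k) ℕ.* C₀) ℕ.^ 3
      ≡⟨ solve 2 (λ c k → (con 2 :* (con 1 :+ con 2 :* k) :* c) :^ 3
                        := con 8 :* (con 1 :+ (k :+ k)) :* (c :^ 3) :* ((con 1 :+ (k :+ k)) :* (con 1 :+ (k :+ k)) :* con 1))
                 refl C₀ k ⟩
    8 ℕ.* o ℕ.* C₀ ℕ.^ 3 ℕ.* (o ℕ.* o ℕ.* 1) ∎
    where open ℕ-Solver

cb/oddSq-factor : ∀ {P k} → P ∣ centralBinomial k →
  ∃ λ w → cb/oddSq k ≡ fromℕ (P ℕ.^ 3) * (+ (w ℕ.^ 3) / oddSq k) {{oddSq-nonZero k}}
cb/oddSq-factor {P} {k} (divides w C≡wP) = w , (begin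
  + (centralBinomial k ℕ.^ 3) / oddSq k
    ≡⟨ ℚ./-cong (cong (λ C → + (C ℕ.^ 3)) C≡wP) refl ⟩
  + ((w ℕ.* P) ℕ.^ 3) / oddSq k
    ≡⟨ ℚ./-cong (cong +_ (solve 2 (λ w P → (w :* P) :^ 3 := (P :^ 3) :* (w :^ 3)) refl w P)) refl ⟩
  + (P ℕ.^ 3 ℕ.* w ℕ.^ 3) / oddSq k
    ≡⟨ fromℕ-*-/ (P ℕ.^ 3) (w ℕ.^ 3) (oddSq k) ⟨
  fromℕ (P ℕ.^ 3) * (+ (w ℕ.^ 3) / oddSq k) ∎)
  where
  open ≡-Reasoning
  open ℕ-Solver
  instance _ = oddSq-nonZero k

certificate : ℚ → ℚ
certificate K = fromℕ 4 * K * K * (fromℕ 4 * K - fromℕ 3)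

telescoping-step : ∀ u Y K α β γ α′ →
  α * ((fromℕ 2 * K - 1ℚ) * (fromℕ 2 * K - 1ℚ)) ≡ γ →
  β * (K + 1ℚ) ≡ γ →
  α′ * ((K + 1ℚ) * (K + 1ℚ)) ≡ fromℕ 8 * (fromℕ 2 * K + 1ℚ) * β →
  α * Y - ((fromℕ 4 - fromℕ 16 * u) * ((K * γ) * Y) + (1ℚ + fromℕ 4 * u) * (γ * Y) - (fromℕ 6 * u) * (β * Y))
    ≡ certificate (K + 1ℚ) * α′ * ((u * (+ 1 / 16)) * Y) - certificate K * α * Y
telescoping-step u Y K α β γ α′ αγ βγ α′β = begin
  α * Y - ((fromℕ 4 - fromℕ 16 * u) * ((K * γ) * Y) + (1ℚ + fromℕ 4 * u) * (γ * Y) - (fromℕ 6 * u) * (β * Y))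
    ≡⟨ solve 6 (λ u Y K α β γ →
         α :* Y :- ((⟨ 4 ⟩ :- ⟨ 16 ⟩ :* u) :* ((K :* γ) :* Y) :+ (⟨ 1 ⟩ :+ ⟨ 4 ⟩ :* u) :* (γ :* Y) :- (⟨ 6 ⟩ :* u) :* (β :* Y))
      := (α :* Y :- (⟨ 4 ⟩ :* K :+ ⟨ 1 ⟩) :* (γ :* Y)) :+ u :* ((⟨ 16 ⟩ :* K :- ⟨ 4 ⟩) :* (γ :* Y) :+ ⟨ 6 ⟩ :* (β :* Y)))
         refl u Y K α β γ ⟩
  (α * Y - (fromℕ 4 * K + 1ℚ) * (γ * Y)) + u * ((fromℕ 16 * K - fromℕ 4) * (γ * Y) + fromℕ 6 * (β * Y))
    ≡⟨ cong₂ _+_ α-part β-part ⟩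
  ℚ.- (certificate K * α * Y) + certificate (K + 1ℚ) * α′ * Y′
    ≡⟨ ℚ.+-comm (ℚ.- (certificate K * α * Y)) (certificate (K + 1ℚ) * α′ * Y′) ⟩
  certificate (K + 1ℚ) * α′ * Y′ - certificate K * α * Y ∎
  where
  open ≡-Reasoning
  open ℚ-Solver
  Y′ = (u * (+ 1 / 16)) * Y
  certificate′ : ∀ {m} → Polynomial m → Polynomial m
  certificate′ K = ⟨ 4 ⟩ :* K :* K :* (⟨ 4 ⟩ :* K :- ⟨ 3 ⟩)

  α-part : α * Y - (fromℕ 4 * K + 1ℚ) * (γ * Y) ≡ ℚ.- (certificate K * α * Y)
  α-part = begin
    α * Y - (fromℕ 4 * K + 1ℚ) * (γ * Y)
      ≡⟨ cong (λ γ → α * Y - (fromℕ 4 * K + 1ℚ) * (γ * Y)) (sym αγ) ⟩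
    α * Y - (fromℕ 4 * K + 1ℚ) * ((α * ((fromℕ 2 * K - 1ℚ) * (fromℕ 2 * K - 1ℚ))) * Y)
      ≡⟨ solve 3 (λ Y K α → α :* Y :- (⟨ 4 ⟩ :* K :+ ⟨ 1 ⟩) :* ((α :* ((⟨ 2 ⟩ :* K :- ⟨ 1 ⟩) :* (⟨ 2 ⟩ :* K :- ⟨ 1 ⟩))) :* Y)
                         := :- (certificate′ K :* α :* Y)) refl Y K α ⟩
    ℚ.- (certificate K * α * Y) ∎

  β-part : u * ((fromℕ 16 * K - fromℕ 4) * (γ * Y) + fromℕ 6 * (β * Y)) ≡ certificate (K + 1ℚ) * α′ * Y′
  β-part = begin
    u * ((fromℕ 16 * K - fromℕ 4) * (γ * Y) + fromℕ 6 * (β * Y))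
      ≡⟨ cong (λ γ → u * ((fromℕ 16 * K - fromℕ 4) * (γ * Y) + fromℕ 6 * (β * Y))) (sym βγ) ⟩
    u * ((fromℕ 16 * K - fromℕ 4) * ((β * (K + 1ℚ)) * Y) + fromℕ 6 * (β * Y))
      ≡⟨ solve 4 (λ u Y K β → u :* ((⟨ 16 ⟩ :* K :- ⟨ 4 ⟩) :* ((β :* (K :+ ⟨ 1 ⟩)) :* Y) :+ ⟨ 6 ⟩ :* (β :* Y))
                           := ⟨ 4 ⟩ :* (⟨ 4 ⟩ :* K :+ ⟨ 1 ⟩) :* (⟨ 8 ⟩ :* (⟨ 2 ⟩ :* K :+ ⟨ 1 ⟩) :* β) :* ((u :* con (+ 1 / 16)) :* Y))
                 refl u Y K β ⟩
    fromℕ 4 * (fromℕ 4 * K + 1ℚ) * (fromℕ 8 * (fromℕ 2 * K + 1ℚ) * β) * Y′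
      ≡⟨ cong (λ x → fromℕ 4 * (fromℕ 4 * K + 1ℚ) * x * Y′) (sym α′β) ⟩
    fromℕ 4 * (fromℕ 4 * K + 1ℚ) * (α′ * ((K + 1ℚ) * (K + 1ℚ))) * Y′
      ≡⟨ solve 3 (λ K α′ Y′ → ⟨ 4 ⟩ :* (⟨ 4 ⟩ :* K :+ ⟨ 1 ⟩) :* (α′ :* ((K :+ ⟨ 1 ⟩) :* (K :+ ⟨ 1 ⟩))) :* Y′
                            := certificate′ (K :+ ⟨ 1 ⟩) :* α′ :* Y′) refl K α′ Y′ ⟩
    certificate (K + 1ℚ) * α′ * Y′ ∎

certificate-at-half : ∀ K P → fromℕ 2 * K ≡ P + 1ℚ → certificate K + 1ℚ ≡ P * P * (fromℕ 2 * P + fromℕ 3)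
certificate-at-half K P 2K≡P+1 = begin
  certificate K + 1ℚ
    ≡⟨ solve 1 (λ K → ⟨ 4 ⟩ :* K :* K :* (⟨ 4 ⟩ :* K :- ⟨ 3 ⟩) :+ ⟨ 1 ⟩
                    := (⟨ 2 ⟩ :* K) :* (⟨ 2 ⟩ :* K) :* (⟨ 2 ⟩ :* (⟨ 2 ⟩ :* K) :- ⟨ 3 ⟩) :+ ⟨ 1 ⟩) refl K ⟩
  (fromℕ 2 * K) * (fromℕ 2 * K) * (fromℕ 2 * (fromℕ 2 * K) - fromℕ 3) + 1ℚ
    ≡⟨ cong (λ x → x * x * (fromℕ 2 * x - fromℕ 3) + 1ℚ) 2K≡P+1 ⟩
  (P + 1ℚ) * (P + 1ℚ) * (fromℕ 2 * (P + 1ℚ) - fromℕ 3) + 1ℚ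
    ≡⟨ solve 1 (λ P → (P :+ ⟨ 1 ⟩) :* (P :+ ⟨ 1 ⟩) :* (⟨ 2 ⟩ :* (P :+ ⟨ 1 ⟩) :- ⟨ 3 ⟩) :+ ⟨ 1 ⟩
                    := P :* P :* (⟨ 2 ⟩ :* P :+ ⟨ 3 ⟩)) refl P ⟩
  P * P * (fromℕ 2 * P + fromℕ 3) ∎
  where
  open ≡-Reasoning
  open ℚ-Solver

-- u stands for 1/m, so that y is the statement's inv16 m once u := 1/ m.
module Telescoping (u : ℚ) where

  y : ℚ
  y = u * (+ 1 / 16)

  leftTerm kcbTerm cbTerm cb/sucTerm rightTerm : ℕ → ℚ
  leftTerm k   = cb/oddSq k * (y ^ℚ k)
  kcbTerm k    = (fromℕ k * cb/1 k) * (y ^ℚ k)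
  cbTerm k     = cb/1 k * (y ^ℚ k)
  cb/sucTerm k = cb/suc k * (y ^ℚ k)
  rightTerm k  = (fromℕ 4 - fromℕ 16 * u) * kcbTerm k + (1ℚ + fromℕ 4 * u) * cbTerm k - (fromℕ 6 * u) * cb/sucTerm k

  rightSum : ℕ → ℚ
  rightSum N = (fromℕ 4 - fromℕ 16 * u) * sumTo N kcbTerm
             + (1ℚ + fromℕ 4 * u) * sumTo N cbTerm
             - (fromℕ 6 * u) * sumTo N cb/sucTerm

  telescoper : ℕ → ℚ
  telescoper k = certificate (fromℕ k) * cb/oddSq k * (y ^ℚ k)

  telescoping-term : ∀ k → leftTerm k - rightTerm k ≡ telescoper (suc k) - telescoper k
  telescoping-term k = begin
    leftTerm k - rightTerm k
      ≡⟨ telescoping-step u (y ^ℚ k) (fromℕ k) (cb/oddSq k) (cb/suc k) (cb/1 k) (cb/oddSq (suc k))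
           (cb/oddSq-*-oddSq k) (cb/suc-*-suc k) (cb/oddSq-suc k) ⟩
    certificate (fromℕ k + 1ℚ) * cb/oddSq (suc k) * (y ^ℚ suc k) - telescoper k
      ≡⟨ cong (λ K → certificate K * cb/oddSq (suc k) * (y ^ℚ suc k) - telescoper k) (fromℕ-+1 k) ⟩
    telescoper (suc k) - telescoper k ∎
    where open ≡-Reasoning

  telescoping-sum : ∀ N → sumTo N leftTerm - rightSum N ≡ telescoper (suc N)
  telescoping-sum zero = trans (telescoping-term 0) (ℚ.+-identityʳ (telescoper 1))
  telescoping-sum (suc N) = begin
    sumTo (suc N) leftTerm - rightSum (suc N)
      ≡⟨ solve 11 (λ L K C S l k c s x₁ x₂ x₃ →
             (L :+ l) :- (x₁ :* (K :+ k) :+ x₂ :* (C :+ c) :- x₃ :* (S :+ s))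
          := (L :- (x₁ :* K :+ x₂ :* C :- x₃ :* S)) :+ (l :- (x₁ :* k :+ x₂ :* c :- x₃ :* s)))
           refl (sumTo N leftTerm) (sumTo N kcbTerm) (sumTo N cbTerm) (sumTo N cb/sucTerm)
           (leftTerm (suc N)) (kcbTerm (suc N)) (cbTerm (suc N)) (cb/sucTerm (suc N))
           (fromℕ 4 - fromℕ 16 * u) (1ℚ + fromℕ 4 * u) (fromℕ 6 * u) ⟩
    (sumTo N leftTerm - rightSum N) + (leftTerm (suc N) - rightTerm (suc N))
      ≡⟨ cong₂ _+_ (telescoping-sum N) (telescoping-term (suc N)) ⟩
    telescoper (suc N) + (telescoper (suc (suc N)) - telescoper (suc N))
      ≡⟨ solve 2 (λ a b → a :+ (b :- a) := b) refl (telescoper (suc N)) (telescoper (suc (suc N))) ⟩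
    telescoper (suc (suc N)) ∎
    where
    open ≡-Reasoning
    open ℚ-Solver

parity : ∀ n → ∃ λ h → n ≡ h ℕ.+ h ⊎ n ≡ suc (h ℕ.+ h)
parity zero = 0 , inj₁ refl
parity (suc n) with parity n
... | h , inj₁ n≡2h   = h , inj₂ (cong suc n≡2h)
... | h , inj₂ n≡2h+1 = suc h , inj₁ (cong suc (trans n≡2h+1 (sym (ℕ.+-suc h h))))

odd-prime-shape : ∀ {p} → Prime p → ¬ 2 ∣ p → ∃ λ n′ → p ≡ suc (suc n′ ℕ.+ suc n′)
odd-prime-shape {p} p-prime p-odd with parity p
... | h , inj₁ refl      = ⊥-elim (p-odd (divides h (trans (cong (h ℕ.+_) (sym (ℕ.+-identityʳ h))) (ℕ.*-comm 2 h))))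
... | zero , inj₂ refl   = ⊥-elim (¬prime[1] p-prime)
... | suc n′ , inj₂ refl = n′ , refl

[n+n]/2≡n : ∀ n → (n ℕ.+ n) ℕ./ 2 ≡ n
[n+n]/2≡n n = trans (cong (ℕ._/ 2) (trans (cong (n ℕ.+_) (sym (ℕ.+-identityʳ n))) (ℕ.*-comm 2 n))) (m*n/n≡m n 2)

tail-index-bounds : ∀ {n′ i} → i < n′ →
  let n = suc n′ ; p = suc (n ℕ.+ n) ; k = suc (suc n) ℕ.+ i
  in k < p × p ≤ 2 ℕ.* k × p < absOdd k × absOdd k < p ℕ.+ p
tail-index-bounds {i = i} i<n′ with ℕ.m≤n⇒∃[o]m+o≡n i<n′
... | d , refl =
  ≤-offset d (solve 2 (λ i d → suc′ (k′ i d) :+ d := p′ i d) refl i d) ,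
  ≤-offset (3 ℕ.+ 2 ℕ.* i) (solve 2 (λ i d → p′ i d :+ (con 3 :+ con 2 :* i) := con 2 :* k′ i d) refl i d) ,
  ≤-offset (1 ℕ.+ 2 ℕ.* i) (solve 2 (λ i d → suc′ (p′ i d) :+ (con 1 :+ con 2 :* i) := o′ i d) refl i d) ,
  ≤-offset (2 ℕ.+ 2 ℕ.* d) (solve 2 (λ i d → suc′ (o′ i d) :+ (con 2 :+ con 2 :* d) := p′ i d :+ p′ i d) refl i d)
  where
  open ℕ-Solver
  ≤-offset : ∀ {a b} e → a ℕ.+ e ≡ b → a ≤ b
  ≤-offset e refl = ℕ.m≤m+n _ e
  suc′ : ∀ {m} → Polynomial m → Polynomial m
  suc′ x = con 1 :+ x
  n′ p′ k′ o′ : ∀ {m} → Polynomial m → Polynomial m → Polynomial m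
  n′ i d = suc′ (suc′ i :+ d)
  p′ i d = suc′ (n′ i d :+ n′ i d)
  k′ i d = suc′ (suc′ (n′ i d)) :+ i
  o′ i d = suc′ ((suc′ (n′ i d) :+ i) :+ (suc′ (n′ i d) :+ i))

module OddPrime (n′ : ℕ) (p-prime : Prime (suc (suc n′ ℕ.+ suc n′)))
                (u : ℚ) (u∈ℤp : InZp (suc (suc n′ ℕ.+ suc n′)) u) where

  open Telescoping u

  n p : ℕ
  n = suc n′
  p = suc (n ℕ.+ n)

  p³ : ℚ
  p³ = fromℕ (p ℕ.^ 3)

  n+1<p : suc n < p
  n+1<p = s≤s (s≤s (ℕ.m≤n+m (suc n′) n′))

  p≤2[n+1] : p ≤ 2 ℕ.* suc n
  p≤2[n+1] = ℕ.≤-trans (ℕ.n≤1+n p) (ℕ.≤-reflexive (solve 1 (λ n → con 2 :+ (n :+ n) := con 2 :* (con 1 :+ n)) refl n))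
    where open ℕ-Solver

  2[n+1]≡p+1 : fromℕ 2 * fromℕ (suc n) ≡ fromℕ p + 1ℚ
  2[n+1]≡p+1 = begin
    fromℕ 2 * fromℕ (suc n)   ≡⟨ fromℕ-* 2 (suc n) ⟨
    fromℕ (2 ℕ.* suc n)       ≡⟨ cong fromℕ (solve 1 (λ n → con 2 :* (con 1 :+ n) := (con 1 :+ (n :+ n)) :+ con 1) refl n) ⟩
    fromℕ (p ℕ.+ 1)           ≡⟨ fromℕ-+ p 1 ⟩
    fromℕ p + 1ℚ              ∎
    where
    open ≡-Reasoning
    open ℕ-Solver

  y∈ℤp : InZp p y
  y∈ℤp = InZp-* p-prime u (+ 1 / 16) u∈ℤp (InZp-/ p-prime (+ 1) 16 p∤16)
    where
    p∤2 : ¬ p ∣ 2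
    p∤2 = >⇒∤ (ℕ.≤-trans (s≤s (s≤s (s≤s z≤n))) n+1<p)
    p∤16 : ¬ p ∣ 16
    p∤16 = prime-∤-* p-prime p∤2 (prime-∤-* p-prime p∤2 (prime-∤-* p-prime p∤2 p∤2))

  boundary-from-factor : ∀ w → cb/oddSq (suc n) ≡ p³ * (+ (w ℕ.^ 3) / (p ℕ.* p)) →
    Multiple p p³ (sumTo (suc n) leftTerm - rightSum n)
  boundary-from-factor w factored = z , z∈ℤp , (begin
    sumTo (suc n) leftTerm - rightSum n
      ≡⟨ solve 3 (λ S l R → (S :+ l) :- R := (S :- R) :+ l) refl (sumTo n leftTerm) (leftTerm (suc n)) (rightSum n) ⟩
    (sumTo n leftTerm - rightSum n) + leftTerm (suc n)
      ≡⟨ cong (λ x → x + leftTerm (suc n)) (telescoping-sum n) ⟩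
    telescoper (suc n) + leftTerm (suc n)
      ≡⟨ solve 3 (λ c a Y → c :* a :* Y :+ a :* Y := (c :+ ⟨ 1 ⟩) :* a :* Y)
                 refl (certificate (fromℕ (suc n))) (cb/oddSq (suc n)) Y ⟩
    (certificate (fromℕ (suc n)) + 1ℚ) * cb/oddSq (suc n) * Y
      ≡⟨ cong₂ (λ a b → a * b * Y) (certificate-at-half (fromℕ (suc n)) P 2[n+1]≡p+1) factored ⟩
    P * P * Q * (p³ * v) * Y
      ≡⟨ solve 5 (λ P Q p³ v Y → P :* P :* Q :* (p³ :* v) :* Y := p³ :* (Q :* (v :* (P :* P)) :* Y)) refl P Q p³ v Y ⟩
    p³ * (Q * (v * (P * P)) * Y)
      ≡⟨ cong (λ x → p³ * (Q * x * Y)) (trans (cong (v *_) (sym (fromℕ-* p p))) (/-*-cancel (w ℕ.^ 3) (p ℕ.* p))) ⟩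
    p³ * z ∎)
    where
    open ≡-Reasoning
    open ℚ-Solver
    P = fromℕ p
    Q = fromℕ 2 * P + fromℕ 3
    Y = y ^ℚ suc n
    v = + (w ℕ.^ 3) / (p ℕ.* p)
    z = Q * fromℕ (w ℕ.^ 3) * Y
    z∈ℤp : InZp p z
    z∈ℤp = InZp-* p-prime (Q * fromℕ (w ℕ.^ 3)) Y
             (InZp-* p-prime Q (fromℕ (w ℕ.^ 3))
               (InZp-+ p-prime (fromℕ 2 * P) (fromℕ 3)
                 (InZp-* p-prime (fromℕ 2) P (InZp-fromℕ p-prime 2) (InZp-fromℕ p-prime p))
                 (InZp-fromℕ p-prime 3))
               (InZp-fromℕ p-prime (w ℕ.^ 3)))
             (InZp-^ p-prime y y∈ℤp (suc n))

  boundary : Multiple p p³ (sumTo (suc n) leftTerm - rightSum n)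
  boundary = uncurry boundary-from-factor (cb/oddSq-factor {p} {suc n} (prime∣centralBinomial p-prime n+1<p p≤2[n+1]))

  leftTerm-from-factor : ∀ k → ¬ p ∣ absOdd k → ∀ w →
    cb/oddSq k ≡ p³ * (+ (w ℕ.^ 3) / oddSq k) {{oddSq-nonZero k}} → Multiple p p³ (leftTerm k)
  leftTerm-from-factor k p∤o w factored = v * Y , InZp-* p-prime v Y v∈ℤp (InZp-^ p-prime y y∈ℤp k) , (begin
    cb/oddSq k * Y     ≡⟨ cong (_* Y) factored ⟩
    p³ * v * Y         ≡⟨ ℚ.*-assoc p³ v Y ⟩
    p³ * (v * Y)       ∎)
    where
    open ≡-Reasoning
    instance _ = oddSq-nonZero k
    Y = y ^ℚ k
    v = + (w ℕ.^ 3) / oddSq k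
    v∈ℤp : InZp p v
    v∈ℤp = InZp-/ p-prime (+ (w ℕ.^ 3)) (oddSq k) (prime-∤-* p-prime p∤o p∤o)

  tail : ∀ i → i < n′ → Multiple p p³ (leftTerm (suc (suc n) ℕ.+ i))
  tail i i<n′ =
    let k<p , p≤2k , p<o , o<2p = tail-index-bounds i<n′
        k = suc (suc n) ℕ.+ i
    in uncurry (leftTerm-from-factor k (∤-between p<o o<2p))
               (cb/oddSq-factor {p} {k} (prime∣centralBinomial p-prime k<p p≤2k))

  congruence : Multiple p p³ (sumTo (n ℕ.+ n) leftTerm - rightSum n)
  congruence = subst (λ N → Multiple p p³ (sumTo N leftTerm - rightSum n)) (cong suc (sym (ℕ.+-suc n′ n′)))
                 (Multiple-sumTo-extend p-prime {p³} {suc n} {n′} {leftTerm} {rightSum n} boundary tail)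

theorem5p2 : (p : ℕ) → Prime p → ¬ (2 ∣ p) →
    (m : ℚ) → InZp p m → ¬ (p ∣ ℤ.∣ ↥ m ∣) → .{{_ : ℚ.NonZero m}} →
    CongMod p 3
      (sumTo (p ∸ 1) (λ k → _/_ (cb k) (oddSq k) {{oddSq-nonZero k}} ℚ.* (inv16 m ^ℚ k)))
      (((+ 4 / 1) ℚ.- (+ 16 / 1) ℚ.÷ m)
          ℚ.* sumTo ((p ∸ 1) ℕ./ 2) (λ k → ((+ k / 1) ℚ.* (cb k / 1)) ℚ.* (inv16 m ^ℚ k))
        ℚ.+ ((+ 1 / 1) ℚ.+ (+ 4 / 1) ℚ.÷ m)
          ℚ.* sumTo ((p ∸ 1) ℕ./ 2) (λ k → (cb k / 1) ℚ.* (inv16 m ^ℚ k))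
        ℚ.- ((+ 6 / 1) ℚ.÷ m)
          ℚ.* sumTo ((p ∸ 1) ℕ./ 2) (λ k → (cb k / suc k) ℚ.* (inv16 m ^ℚ k)))
theorem5p2 p p-prime p-odd m _ p∤↥m with odd-prime-shape p-prime p-odd
... | n′ , refl rewrite [n+n]/2≡n (suc n′) =
  OddPrime.congruence n′ p-prime (1/ m) (InZp-1/ m p∤↥m)
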